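{- Consider an execution of the algorithm $\mathtt{Follow}$ on a simple temporal graph $\mathcal{G}=(V,E,\lambda)$ with parameter $\delta\in\mathbb{N}^+$. If the execution discovers (i.e., observes a successful infection along, and thus learns the label of) some edge belonging to a $\delta$-edge connected component of $\mathcal{G}$, then it discovers every edge of that $\delta$-edge connected component.
   Context: A simple temporal graph $\mathcal{G}=(V,E,\lambda)$ with lifetime $T_{\max}$ has a finite undirected static graph $(V,E)$ and labeling $\lambda:E\to\{1,\dots,T_{\max}\}$. $\delta$-edge connected components: relate two edges if they share an endpoint and their labels differ by at most $\delta$; the equivalence classes of the reflexive-transitive closure of this relation are the $\delta$-edge connected components. Infection model with parameter $\delta$: all nodes start susceptible; a seed infection $(v,t)$ makes $v$ infected at time $t$; otherwise a susceptible node $u$ becomes infected at time $t$ iff some node $w$ infectious at time $t$ has an edge $uw$ with $\lambda(uw)=t$ (if several, exactly one infects $u$, chosen by the Adversary); a node infected at time $t$ is infectious at times $t+1,\dots,t+\delta$ and resistant afterwards. Each round the algorithm submits a seed set and observes an infection log (triples $(u,w,s)$: $u$ infected $w$ at time $s$), revealing $\lambda(uw)=s$. Subroutine $\mathtt{Explore}(u,t)$: (1) for each $t'\in\{t-\delta-1,t-1,t\}$, if no round with seed infection $(u,t')$ has been performed, perform a round with the single seed $(u,t')$ and record it; (2) for each edge $uw$ along which $u$ newly infected $w$ in these rounds, at time $s$, call $\mathtt{Explore}(w,s)$. Algorithm $\mathtt{Follow}$: pick $v_0\in V$ arbitrarily; for each $i\in\{0,\dots,\lceil T_{\max}/\delta\rceil\}$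 perform a round with the single seed $(v_0,i\delta)$; for each edge $e=v_0u$ along which an infection succeeded, call $\mathtt{Explore}(u,\lambda(e))$. -}

module Defs where

open import Data.Nat as ℕ using (ℕ; zero; suc; NonZero; ∣_-_∣)
open import Data.Nat.DivMod using (_/_)
open import Data.Integer as ℤ using (ℤ; +_)
open import Data.Fin using (Fin; toℕ)
open import Data.Maybe using (Maybe; just; nothing)
open import Data.Product using (Σ; ∃; _×_; _,_)
open import Data.Sum using (_⊎_)
open import Data.List using (List; []; _∷_; _++_)
open import Data.List.Membership.Propositional using (_∈_)
open import Data.List.Relation.Unary.Unique.Propositional using (Unique)
open import Data.Vec using (Vec; lookup; toList)
open import Relation.Nullary using (¬_)
open import Relation.Binary.PropositionalEquality using (_≡_)
open import Relation.Binary.Construct.Closure.ReflexiveTransitive using (Star)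

-- Simple temporal graphs on the vertex set Fin n.
-- lab u w ≡ just ℓ  means  uw ∈ E  and  λ(uw) = ℓ ;  nothing = no edge.

record TGraph (n : ℕ) : Set where
  field
    Tmax   : ℕ
    lab    : Fin n → Fin n → Maybe ℕ
    sym    : ∀ u w → lab u w ≡ lab w u
    loopless : ∀ u → lab u u ≡ nothing
    bounds : ∀ u w ℓ → lab u w ≡ just ℓ → (1 ℕ.≤ ℓ) × (ℓ ℕ.≤ Tmax)
open TGraph public

module _ {n : ℕ} (G : TGraph n) (δ : ℕ) where

  -- δ-edge connected components (edges as ordered pairs; (a,b) and (b,a)
  -- denote the same edge and are related by one step).

  Edge : Fin n → Fin n → Set
  Edge a b = ∃ λ ℓ → lab G a b ≡ just ℓ

  ShareEndpoint : Fin n × Fin n → Fin n × Fin n → Set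
  ShareEndpoint (a , b) (c , d) = (a ≡ c) ⊎ (a ≡ d) ⊎ (b ≡ c) ⊎ (b ≡ d)

  δAdj : Fin n × Fin n → Fin n × Fin n → Set
  δAdj (a , b) (c , d) =
    Σ ℕ λ ℓ → Σ ℕ λ ℓ' → lab G a b ≡ just ℓ × lab G c d ≡ just ℓ'
      × ShareEndpoint (a , b) (c , d) × ∣ ℓ - ℓ' ∣ ℕ.≤ δ

  SameComp : Fin n × Fin n → Fin n × Fin n → Set
  SameComp = Star δAdj

  data Status : Set where
    susceptible : Status
    seeded      : ℤ → Status
    infectedBy  : Fin n → ℤ → Status

  infTime : Status → Maybe ℤ
  infTime susceptible      = nothing
  infTime (seeded t)       = just t
  infTime (infectedBy _ s) = just s

  record Round : Set where
    field
      seed   : Fin n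
      stime  : ℤ
      status : Fin n → Status      -- the outcome (Adversary's choices included)
  open Round public

  -- Validity of an outcome w.r.t. the infection model with parameter δ.
  -- A node infected at time s is infectious at times s+1,…,s+δ.
  record ValidRound (r : Round) : Set where
    field
      seedOk   : status r (seed r) ≡ seeded (stime r)
      onlySeed : ∀ u t → status r u ≡ seeded t → u ≡ seed r
      justified : ∀ u w s → status r u ≡ infectedBy w s →
        Σ ℤ λ sw → Σ ℕ λ ℓ → infTime (status r w) ≡ just sw
          × sw ℤ.< s × s ℤ.≤ sw ℤ.+ + δ
          × lab G u w ≡ just ℓ × s ≡ + ℓ
      forced : ∀ u w sw ℓ → infTime (status r w) ≡ just sw →
        lab G u w ≡ just ℓ → sw ℤ.< + ℓ → + ℓ ℤ.≤ sw ℤ.+ + δ →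
        Σ ℤ λ s → infTime (status r u) ≡ just s × s ℤ.≤ + ℓ

  -- the log of round r contains the triple (a , b , s)
  Logged : Round → Fin n → Fin n → ℤ → Set
  Logged r a b s = status r b ≡ infectedBy a s

  State : Set
  State = List Round

  Performed : State → Fin n → ℤ → Set
  Performed S u t = ∃ λ r → r ∈ S × seed r ≡ u × stime r ≡ t

  IsRoundFor : Fin n → ℤ → Round → Set
  IsRoundFor u t r = seed r ≡ u × stime r ≡ t × ValidRound r

  -- "if no round with seed (u,t') has been performed, perform one";
  -- last index = the rounds newly performed
  data Try (u : Fin n) (t : ℤ) : State → State → List Round → Set where
    skip    : ∀ {S} → Performed S u t → Try u t S S []
    perform : ∀ {S} r → ¬ Performed S u t → IsRoundFor u t r →
              Try u t S (S ++ r ∷ []) (r ∷ [])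

  CallsOf : Fin n → List Round → List (Fin n × ℤ) → Set
  CallsOf u rs calls = Unique calls ×
    (∀ w s → ((w , s) ∈ calls → ∃ λ r → r ∈ rs × Logged r u w s)
           × ((∃ λ r → r ∈ rs × Logged r u w s) → (w , s) ∈ calls))

  -- big-step semantics of Explore (state before, state after)
  data Explore : Fin n → ℤ → State → State → Set
  data ExploreAll : List (Fin n × ℤ) → State → State → Set

  data Explore where
    explore : ∀ {u t S₀ S₁ S₂ S₃ S₄ n₁ n₂ n₃ calls} →
      Try u (t ℤ.- + suc δ) S₀ S₁ n₁ →
      Try u (t ℤ.- + 1) S₁ S₂ n₂ →
      Try u t S₂ S₃ n₃ →
      CallsOf u (n₁ ++ n₂ ++ n₃) calls →
      ExploreAll calls S₃ S₄ →
      Explore u t S₀ S₄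

  data ExploreAll where
    done : ∀ {S} → ExploreAll [] S S
    next : ∀ {w s rest S₀ S₁ S₂} → Explore w s S₀ S₁ →
           ExploreAll rest S₁ S₂ → ExploreAll ((w , s) ∷ rest) S₀ S₂

  ceilDiv : (m d : ℕ) → .{{NonZero d}} → ℕ
  ceilDiv m d = (m ℕ.+ d ℕ.∸ 1) / d

  data FollowRun .{{_ : NonZero δ}} : State → Set where
    follow : ∀ (v₀ : Fin n) (init : Vec Round (suc (ceilDiv (Tmax G) δ)))
      (calls : List (Fin n × ℤ)) (S : State) →
      (∀ i → IsRoundFor v₀ (+ (toℕ i ℕ.* δ)) (lookup init i)) →
      CallsOf v₀ (toList init) calls →
      ExploreAll calls (toList init) S →
      FollowRun S

  Discovered : State → Fin n → Fin n → Set
  Discovered S a b = ∃ λ r → r ∈ S × ∃ λ s → (Logged r a b s ⊎ Logged r b a s)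

-- Call u explored at time t once the rounds seeded at (u , t - δ - 1), (u , t - 1) and (u , t)
-- have been performed; in a completed run, every vertex infected by the seed of a round at time s
-- is explored at s.  If u is explored at ℓ, the round seeded at ℓ - 1 infects along every edge uw
-- labelled ℓ, so uw is discovered and w is explored at ℓ too.  For an edge uc labelled ℓ' with
-- ∣ ℓ - ℓ' ∣ ≤ δ, the round seeded at ℓ or at ℓ - δ - 1 is infectious at ℓ': either it infects c
-- then, or u infects someone earlier, which makes u explored at a time closer to ℓ'.  Hence the
-- edges explored at both ends at their label are closed under δ-adjacency and are discovered; and
-- every discovered edge is among them, by induction along the chain of infections leading to it.
module Submission where

open import Defs hiding (sym)
open import Data.Nat using (ℕ; NonZero)
open import Data.Fin using (Fin)
open import Data.Product using (_,_)

open import Data.Nat using (suc; z<s; s≤s; _<_; _≤_; _+_; _∸_; ∣_-_∣; >-nonZero⁻¹)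
import Data.Nat.Properties as ℕₚ
open import Data.Nat.Induction using (<-wellFounded)
open import Induction.WellFounded using (Acc; acc)
open import Data.Integer as ℤ using (ℤ; +_; +<+; +≤+)
import Data.Integer.Properties as ℤₚ
open import Data.Integer.Tactic.RingSolver using (solve-∀)
open import Data.Maybe using (just)
open import Data.Maybe.Properties using (just-injective)
open import Data.Product using (∃; ∃₂; _×_; proj₁; proj₂; uncurry)
open import Data.Vec using (toList)
open import Data.Sum using (_⊎_; inj₁; inj₂; [_,_]′)
open import Data.Empty using (⊥; ⊥-elim)
open import Data.List using (_++_)
open import Data.List.Membership.Propositional using (_∈_)
open import Data.List.Membership.Propositional.Properties using (∈-++⁺ˡ; ∈-++⁺ʳ; ∈-++⁻)
open import Data.List.Relation.Binary.Subset.Propositional using (_⊆_)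
open import Data.List.Relation.Binary.Subset.Propositional.Properties using (⊆-refl; ⊆-trans)
open import Data.List.Relation.Unary.Any using (here; there)
import Data.Vec.Relation.Unary.All as VecAll
open import Data.Vec.Relation.Unary.All.Properties using (lookup⁻)
open import Data.Vec.Membership.Propositional.Properties using (∈-toList⁻)
open import Function using (_∘_; id)
open import Relation.Binary.PropositionalEquality
  using (_≡_; refl; sym; trans; cong; subst)
open import Relation.Binary.Construct.Closure.ReflexiveTransitive using (fold)
open import Relation.Binary.Definitions using (tri<; tri≈; tri>)

i-k+k≡i : ∀ i k → i ℤ.- k ℤ.+ k ≡ i
i-k+k≡i = solve-∀

i+k-k≡i : ∀ i k → i ℤ.+ k ℤ.- k ≡ i
i+k-k≡i = solve-∀

i-k+d≡i+d-k : ∀ i k d → i ℤ.- k ℤ.+ d ≡ i ℤ.+ d ℤ.- k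
i-k+d≡i+d-k = solve-∀

i-k<j⇒i<j+k : ∀ {i j} k → i ℤ.- k ℤ.< j → i ℤ.< j ℤ.+ k
i-k<j⇒i<j+k {i} k lt = subst (ℤ._< _) (i-k+k≡i i k) (ℤₚ.+-monoˡ-< k lt)

i<j+k⇒i-k<j : ∀ {i j} k → i ℤ.< j ℤ.+ k → i ℤ.- k ℤ.< j
i<j+k⇒i-k<j {j = j} k lt = subst (_ ℤ.<_) (i+k-k≡i j k) (ℤₚ.+-monoˡ-< (ℤ.- k) lt)

j+k≤i⇒j≤i-k : ∀ {i j} k → j ℤ.+ k ℤ.≤ i → j ℤ.≤ i ℤ.- k
j+k≤i⇒j≤i-k {j = j} k le = subst (ℤ._≤ _) (i+k-k≡i j k) (ℤₚ.+-monoˡ-≤ (ℤ.- k) le)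

+ℓ-+[1+k]<+m⇒ℓ≤k+m : ∀ {ℓ k m} → + ℓ ℤ.- + suc k ℤ.< + m → ℓ ≤ k + m
+ℓ-+[1+k]<+m⇒ℓ≤k+m {ℓ} {k} {m} lt = ℕₚ.m<1+n⇒m≤n
  (subst (ℓ <_) (ℕₚ.+-comm m (suc k)) (ℤₚ.drop‿+<+ (i-k<j⇒i<j+k (+ suc k) lt)))

module Exploration {n : ℕ} (G : TGraph n) (δ : ℕ) where

  InfectiousAt : ℤ → ℤ → Set
  InfectiousAt t s = t ℤ.< s × s ℤ.≤ t ℤ.+ + δ

  infectiousAt-shifted : ∀ {ℓ ℓ' k} → ℓ < ℓ' + k → ℓ' + k ≤ ℓ + δ →
    InfectiousAt (+ ℓ ℤ.- + k) (+ ℓ')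
  infectiousAt-shifted {ℓ} {ℓ'} {k} lt le =
    i<j+k⇒i-k<j (+ k) (+<+ lt) ,
    subst (+ ℓ' ℤ.≤_) (sym (i-k+d≡i+d-k (+ ℓ) (+ k) (+ δ))) (j+k≤i⇒j≤i-k (+ k) (+≤+ le))

  lab-sym : ∀ {a b ℓ} → lab G a b ≡ just ℓ → lab G b a ≡ just ℓ
  lab-sym {a} {b} ab = trans (TGraph.sym G b a) ab

  lab-functional : ∀ {a b ℓ ℓ'} → lab G a b ≡ just ℓ → lab G a b ≡ just ℓ' → ℓ ≡ ℓ'
  lab-functional ab ab' = just-injective (trans (sym ab) ab')

  lab-irrefl : ∀ {a ℓ} → lab G a a ≡ just ℓ → ⊥
  lab-irrefl {a} aa with trans (sym aa) (loopless G a)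
  ... | ()

  module ValidRoundProperties {r : Round G δ} (valid : ValidRound G δ r) where
    open ValidRound valid

    logged-edge : ∀ {a b s} → Logged G δ r a b s → ∃ λ ℓ → lab G a b ≡ just ℓ × s ≡ + ℓ
    logged-edge lg with justified _ _ _ lg
    ... | _ , ℓ , _ , _ , _ , ba , s≡ℓ = ℓ , lab-sym ba , s≡ℓ

    logged-at-label : ∀ {a b s ℓ} → Logged G δ r a b s → lab G a b ≡ just ℓ → s ≡ + ℓ
    logged-at-label lg ab with logged-edge lg
    ... | _ , ab' , refl = cong +_ (lab-functional ab' ab)

    logged-source : ∀ {a b s} → Logged G δ r a b s →
      ∃ λ t → infTime G δ (status r a) ≡ just t × InfectiousAt t s
    logged-source lg with justified _ _ _ lg
    ... | t , _ , at , t<s , s≤t+δ , _ = t , at , t<s , s≤t+δ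

    infection-source : ∀ {y t} → infTime G δ (status r y) ≡ just t →
      y ≡ seed r ⊎ ∃ λ x → Logged G δ r x y t
    infection-source {y} at with status r y in eq
    infection-source {y} refl | seeded t = inj₁ (onlySeed y t eq)
    infection-source {y} refl | infectedBy x s = inj₂ (x , refl)

    seed-infTime : infTime G δ (status r (seed r)) ≡ just (stime r)
    seed-infTime = cong (infTime G δ) seedOk

    seed-logs-after-stime : ∀ {w s} → Logged G δ r (seed r) w s → stime r ℤ.< s
    seed-logs-after-stime lg with logged-source lg
    ... | _ , at , t<s , _ = subst (ℤ._< _) (just-injective (trans (sym at) seed-infTime)) t<s

    -- Infection times strictly decrease along the chain of infectors, which ends at the seed.
    descends-from-seed : ∀ {y z s} → Logged G δ r y z s →
      Logged G δ r (seed r) z s ⊎ ∃₂ λ y₁ m → Logged G δ r (seed r) y₁ m × m ℤ.< s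
    descends-from-seed lg with logged-edge lg
    ... | ℓ , _ , refl = go (<-wellFounded ℓ) lg
      where
      go : ∀ {y z ℓ} → Acc _<_ ℓ → Logged G δ r y z (+ ℓ) →
        Logged G δ r (seed r) z (+ ℓ) ⊎ ∃₂ λ y₁ m → Logged G δ r (seed r) y₁ m × m ℤ.< + ℓ
      go (acc rec) lg with logged-source lg
      ... | t , at , t<ℓ , _ with infection-source at
      ... | inj₁ refl = inj₁ lg
      ... | inj₂ (_ , lg') with logged-edge lg'
      ... | _ , _ , refl with go (rec (ℤₚ.drop‿+<+ t<ℓ)) lg'
      ...   | inj₁ lg₀ = inj₂ (_ , t , lg₀ , t<ℓ)
      ...   | inj₂ (y₁ , m , lg₁ , m<t) = inj₂ (y₁ , m , lg₁ , ℤₚ.<-trans m<t t<ℓ)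

    seed-first-step : ∀ {c ℓ} → lab G (seed r) c ≡ just ℓ → InfectiousAt (stime r) (+ ℓ) →
      Logged G δ r (seed r) c (+ ℓ)
        ⊎ ∃₂ λ y m → Logged G δ r (seed r) y (+ m) × stime r ℤ.< + m × m < ℓ
    seed-first-step {c} {ℓ} sc (t<ℓ , ℓ≤t+δ)
      with forced c (seed r) (stime r) ℓ seed-infTime (lab-sym sc) t<ℓ ℓ≤t+δ
    ... | _ , at , s≤ℓ with infection-source at
    ... | inj₁ refl = ⊥-elim (lab-irrefl sc)
    ... | inj₂ (_ , lg) with descends-from-seed lg
    ...   | inj₁ lg₀ = inj₁ (subst (Logged G δ r (seed r) c) (logged-at-label lg₀ sc) lg₀)
    ...   | inj₂ (y₁ , m , lg₁ , m<s) with logged-edge lg₁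
    ...     | _ , _ , refl =
      inj₂ (y₁ , _ , lg₁ , seed-logs-after-stime lg₁ , ℤₚ.drop‿+<+ (ℤₚ.<-≤-trans m<s s≤ℓ))

    seed-logs-one-after-stime : .{{_ : NonZero δ}} → ∀ {w ℓ} → stime r ≡ + ℓ ℤ.- + 1 →
      lab G (seed r) w ≡ just ℓ → Logged G δ r (seed r) w (+ ℓ)
    seed-logs-one-after-stime {ℓ = ℓ} t≡ sw
      with seed-first-step sw (subst (λ t → InfectiousAt t (+ ℓ)) (sym t≡)
             (infectiousAt-shifted (ℕₚ.m<m+n ℓ z<s) (ℕₚ.+-monoʳ-≤ ℓ (>-nonZero⁻¹ δ))))
    ... | inj₁ lg = lg
    ... | inj₂ (_ , _ , _ , t<m , m<ℓ) =
      ⊥-elim (ℕₚ.<⇒≱ m<ℓ (+ℓ-+[1+k]<+m⇒ℓ≤k+m (subst (ℤ._< _) t≡ t<m)))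

  Explored : State G δ → Fin n → ℤ → Set
  Explored S u t = Performed G δ S u (t ℤ.- + suc δ) × Performed G δ S u (t ℤ.- + 1)
    × Performed G δ S u t

  FollowedUp : State G δ → Round G δ → Set
  FollowedUp S r = ValidRound G δ r × (∀ {w s} → Logged G δ r (seed r) w s → Explored S w s)

  performed-mono : ∀ {S S' u t} → S ⊆ S' → Performed G δ S u t → Performed G δ S' u t
  performed-mono S⊆S' (r , r∈S , seed≡ , stime≡) = r , S⊆S' r∈S , seed≡ , stime≡

  explored-mono : ∀ {S S' u t} → S ⊆ S' → Explored S u t → Explored S' u t
  explored-mono S⊆S' (p₁ , p₂ , p₃) =
    performed-mono S⊆S' p₁ , performed-mono S⊆S' p₂ , performed-mono S⊆S' p₃

  followedUp-mono : ∀ {S S' r} → S ⊆ S' → FollowedUp S r → FollowedUp S' r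
  followedUp-mono S⊆S' (valid , explored) = valid , explored-mono S⊆S' ∘ explored

  Grows : (Round G δ → Set) → State G δ → State G δ → Set
  Grows P S₀ S₁ = S₀ ⊆ S₁ × (∀ {r} → r ∈ S₁ → r ∈ S₀ ⊎ P r)

  grows-trans : ∀ {P S₀ S₁ S₂} → Grows P S₀ S₁ → Grows P S₁ S₂ → Grows P S₀ S₂
  grows-trans (S₀⊆S₁ , new₁) (S₁⊆S₂ , new₂) =
    ⊆-trans S₀⊆S₁ S₁⊆S₂ , [ new₁ , inj₂ ]′ ∘ new₂

  grows-map : ∀ {P Q S₀ S₁} → (∀ {r} → P r → Q r) → Grows P S₀ S₁ → Grows Q S₀ S₁
  grows-map P⇒Q (S₀⊆S₁ , new) = S₀⊆S₁ , [ inj₁ , inj₂ ∘ P⇒Q ]′ ∘ new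

  try-grows : ∀ {u t S₀ S₁ rs} → Try G δ u t S₀ S₁ rs →
    Grows (λ r → r ∈ rs × IsRoundFor G δ u t r) S₀ S₁
  try-grows (skip _) = ⊆-refl , inj₁
  try-grows {S₀ = S₀} (perform r _ isRound) =
    ∈-++⁺ˡ , [ inj₁ , (λ { (here refl) → inj₂ (here refl , isRound) }) ]′ ∘ ∈-++⁻ S₀

  try-performed : ∀ {u t S₀ S₁ rs} → Try G δ u t S₀ S₁ rs → Performed G δ S₁ u t
  try-performed (skip performed) = performed
  try-performed {S₀ = S₀} (perform r _ (seed≡ , stime≡ , _)) =
    r , ∈-++⁺ʳ S₀ (here refl) , seed≡ , stime≡

  followedUp-by-calls : ∀ {u rs calls S r} → CallsOf G δ u rs calls →
    (∀ {w s} → (w , s) ∈ calls → Explored S w s) →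
    r ∈ rs → seed r ≡ u → ValidRound G δ r → FollowedUp S r
  followedUp-by-calls {r = r} (_ , calls≡) explored r∈rs refl valid =
    valid , λ {w} {s} lg → explored (proj₂ (calls≡ w s) (r , r∈rs , lg))

  explore-grows : ∀ {u t S₀ S₁} → Explore G δ u t S₀ S₁ →
    Grows (FollowedUp S₁) S₀ S₁ × Explored S₁ u t
  exploreAll-grows : ∀ {calls S₀ S₁} → ExploreAll G δ calls S₀ S₁ →
    Grows (FollowedUp S₁) S₀ S₁ × (∀ {w s} → (w , s) ∈ calls → Explored S₁ w s)

  explore-grows {u} {S₁ = S₄}
    (explore {S₁ = S₁} {S₂ = S₂} {n₁ = n₁} {n₂ = n₂} {n₃ = n₃} try₁ try₂ try₃ calls explorations)
    with exploreAll-grows explorations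
  ... | grows₃₄ , explored =
    grows-trans (fresh ∈-++⁺ˡ try₁) grows₁₄ ,
    performed-mono (proj₁ grows₁₄) (try-performed try₁) ,
    performed-mono (proj₁ grows₂₄) (try-performed try₂) ,
    performed-mono (proj₁ grows₃₄) (try-performed try₃)
    where
    fresh : ∀ {t S S' rs} → rs ⊆ n₁ ++ n₂ ++ n₃ → Try G δ u t S S' rs →
      Grows (FollowedUp S₄) S S'
    fresh rs⊆ try = grows-map
      (λ (r∈rs , seed≡ , _ , valid) → followedUp-by-calls calls explored (rs⊆ r∈rs) seed≡ valid)
      (try-grows try)

    grows₂₄ : Grows (FollowedUp S₄) S₂ S₄
    grows₂₄ = grows-trans (fresh (∈-++⁺ʳ n₁ ∘ ∈-++⁺ʳ n₂) try₃) grows₃₄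

    grows₁₄ : Grows (FollowedUp S₄) S₁ S₄
    grows₁₄ = grows-trans (fresh (∈-++⁺ʳ n₁ ∘ ∈-++⁺ˡ) try₂) grows₂₄

  exploreAll-grows done = (⊆-refl , inj₁) , λ ()
  exploreAll-grows (next exploration explorations)
    with explore-grows exploration | exploreAll-grows explorations
  ... | grows₁ , explored₁ | grows₂ , explored₂ =
    grows-trans (grows-map (followedUp-mono (proj₁ grows₂)) grows₁) grows₂ ,
    λ { (here refl) → explored-mono (proj₁ grows₂) explored₁ ; (there w∈) → explored₂ w∈ }

  follow-followedUp : .{{_ : NonZero δ}} → ∀ {S} → FollowRun G δ S →
    ∀ {r} → r ∈ S → FollowedUp S r
  follow-followedUp (follow v₀ init calls S rounds calls≡ explorations)
    with exploreAll-grows explorations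
  ... | (_ , new) , explored = [ initial , id ]′ ∘ new
    where
    initial-valid : VecAll.All (λ r → seed r ≡ v₀ × ValidRound G δ r) init
    initial-valid = lookup⁻ λ i → let seed≡ , _ , valid = rounds i in seed≡ , valid

    initial : ∀ {r} → r ∈ toList init → FollowedUp S r
    initial r∈init = uncurry (followedUp-by-calls calls≡ explored r∈init)
      (VecAll.lookup initial-valid (∈-toList⁻ r∈init))

  module Closed (S : State G δ) (closed : ∀ {r} → r ∈ S → FollowedUp S r)
                .{{_ : NonZero δ}} where

    explored-logs : ∀ {u w ℓ} → Explored S u (+ ℓ) → lab G u w ≡ just ℓ →
      ∃ λ r → r ∈ S × Logged G δ r u w (+ ℓ)
    explored-logs (_ , (r , r∈S , refl , t≡) , _) uw =
      r , r∈S , ValidRoundProperties.seed-logs-one-after-stime (proj₁ (closed r∈S)) t≡ uw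

    explored-spreads : ∀ {u w ℓ} → Explored S u (+ ℓ) → lab G u w ≡ just ℓ → Explored S w (+ ℓ)
    explored-spreads (_ , (r , r∈S , refl , t≡) , _) uw =
      proj₂ (closed r∈S) (ValidRoundProperties.seed-logs-one-after-stime (proj₁ (closed r∈S)) t≡ uw)

    performed-spreads : ∀ {u c t ℓ} → Performed G δ S u t → lab G u c ≡ just ℓ →
      InfectiousAt t (+ ℓ) →
      Explored S c (+ ℓ) ⊎ ∃ λ m → t ℤ.< + m × m < ℓ × Explored S u (+ m)
    performed-spreads (r , r∈S , refl , refl) uc infectious
      with closed r∈S
    ... | valid , followedUp
      with ValidRoundProperties.seed-first-step valid uc infectious
    ... | inj₁ lg = inj₁ (followedUp lg)
    ... | inj₂ (_ , m , lg , t<m , m<ℓ) with ValidRoundProperties.logged-edge valid lg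
    ...   | _ , uy , refl = inj₂ (m , t<m , m<ℓ , explored-spreads (followedUp lg) (lab-sym uy))

    -- The round seeded at (u , ℓ) infects c at ℓ' first-hand, unless u first infects someone at
    -- some m between ℓ and ℓ'; then u is explored at m, closer to ℓ'.
    explored-spreads-later : ∀ {u c ℓ ℓ'} → Explored S u (+ ℓ) → lab G u c ≡ just ℓ' →
      ℓ < ℓ' → ℓ' ≤ ℓ + δ → Explored S c (+ ℓ')
    explored-spreads-later {ℓ = ℓ} {ℓ'} = go (<-wellFounded (ℓ' ∸ ℓ))
      where
      go : ∀ {u c ℓ} → Acc _<_ (ℓ' ∸ ℓ) → Explored S u (+ ℓ) → lab G u c ≡ just ℓ' →
        ℓ < ℓ' → ℓ' ≤ ℓ + δ → Explored S c (+ ℓ')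
      go (acc rec) (_ , _ , performed) uc ℓ<ℓ' ℓ'≤ℓ+δ
        with performed-spreads performed uc (+<+ ℓ<ℓ' , +≤+ ℓ'≤ℓ+δ)
      ... | inj₁ explored = explored
      ... | inj₂ (m , +<+ ℓ<m , m<ℓ' , explored) =
        go (rec (ℕₚ.∸-monoʳ-< ℓ<m (ℕₚ.<⇒≤ m<ℓ'))) explored uc m<ℓ'
           (ℕₚ.≤-trans ℓ'≤ℓ+δ (ℕₚ.+-monoˡ-≤ δ (ℕₚ.<⇒≤ ℓ<m)))

    explored-spreads-earlier : ∀ {u c ℓ ℓ'} → Explored S u (+ ℓ) → lab G u c ≡ just ℓ' →
      ℓ' < ℓ → ℓ ≤ ℓ' + δ → Explored S c (+ ℓ')
    explored-spreads-earlier {ℓ = ℓ} {ℓ'} (performed , _ , _) uc ℓ'<ℓ ℓ≤ℓ'+δ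
      with performed-spreads performed uc (infectiousAt-shifted ℓ<ℓ'+1+δ ℓ'+1+δ≤ℓ+δ)
      where
      ℓ<ℓ'+1+δ : ℓ < ℓ' + suc δ
      ℓ<ℓ'+1+δ = subst (ℓ <_) (sym (ℕₚ.+-suc ℓ' δ)) (s≤s ℓ≤ℓ'+δ)

      ℓ'+1+δ≤ℓ+δ : ℓ' + suc δ ≤ ℓ + δ
      ℓ'+1+δ≤ℓ+δ = subst (_≤ ℓ + δ) (sym (ℕₚ.+-suc ℓ' δ)) (ℕₚ.+-monoˡ-≤ δ ℓ'<ℓ)
    ... | inj₁ explored = explored
    ... | inj₂ (m , t<m , m<ℓ' , explored) =
      explored-spreads-later explored uc m<ℓ'
        (ℕₚ.≤-trans (ℕₚ.<⇒≤ (ℕₚ.<-≤-trans ℓ'<ℓ (+ℓ-+[1+k]<+m⇒ℓ≤k+m t<m)))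
                    (ℕₚ.≤-reflexive (ℕₚ.+-comm δ m)))

    explored-spreads-within-δ : ∀ {u c ℓ ℓ'} → Explored S u (+ ℓ) → lab G u c ≡ just ℓ' →
      ∣ ℓ - ℓ' ∣ ≤ δ → Explored S c (+ ℓ')
    explored-spreads-within-δ {ℓ = ℓ} {ℓ'} explored uc close with ℕₚ.<-cmp ℓ ℓ'
    ... | tri< ℓ<ℓ' _ _ = explored-spreads-later explored uc ℓ<ℓ'
      (ℕₚ.≤-trans (ℕₚ.m≤n+∣n-m∣ ℓ' ℓ) (ℕₚ.+-monoʳ-≤ ℓ close))
    ... | tri≈ _ refl _ = explored-spreads explored uc
    ... | tri> _ _ ℓ'<ℓ = explored-spreads-earlier explored uc ℓ'<ℓ
      (ℕₚ.≤-trans (ℕₚ.m≤n+∣m-n∣ ℓ ℓ') (ℕₚ.+-monoʳ-≤ ℓ' close))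

    logged-explored : ∀ {r x z s} → r ∈ S → Logged G δ r x z s → Explored S z s
    logged-explored {r} r∈S lg with ValidRoundProperties.logged-edge (proj₁ (closed r∈S)) lg
    ... | ℓ , _ , refl = go (<-wellFounded ℓ) lg
      where
      open ValidRoundProperties (proj₁ (closed r∈S))

      go : ∀ {x z ℓ} → Acc _<_ ℓ → Logged G δ r x z (+ ℓ) → Explored S z (+ ℓ)
      go (acc rec) lg with logged-source lg | logged-edge lg
      ... | t , at , t<ℓ , ℓ≤t+δ | _ , xz , refl with infection-source at
      ...   | inj₁ refl = proj₂ (closed r∈S) lg
      ...   | inj₂ (_ , lg') with logged-edge lg'
      ...     | _ , _ , refl = explored-spreads-later (go (rec (ℤₚ.drop‿+<+ t<ℓ)) lg') xz
                                 (ℤₚ.drop‿+<+ t<ℓ) (ℤₚ.drop‿+≤+ ℓ≤t+δ)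

    ExploredEdge : Fin n × Fin n → Set
    ExploredEdge (a , b) = ∃ λ ℓ → lab G a b ≡ just ℓ × Explored S a (+ ℓ) × Explored S b (+ ℓ)

    exploredEdge-sym : ∀ {a b} → ExploredEdge (a , b) → ExploredEdge (b , a)
    exploredEdge-sym (ℓ , ab , explored-a , explored-b) = ℓ , lab-sym ab , explored-b , explored-a

    exploredEdge-from : ∀ {a b ℓ} → Explored S a (+ ℓ) → lab G a b ≡ just ℓ → ExploredEdge (a , b)
    exploredEdge-from explored ab = _ , ab , explored , explored-spreads explored ab

    discovered⇒exploredEdge : ∀ {a b} → Discovered G δ S a b → ExploredEdge (a , b)
    discovered⇒exploredEdge (r , r∈S , _ , inj₁ lg)
      with ValidRoundProperties.logged-edge (proj₁ (closed r∈S)) lg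
    ... | _ , ab , refl = exploredEdge-sym (exploredEdge-from (logged-explored r∈S lg) (lab-sym ab))
    discovered⇒exploredEdge (r , r∈S , _ , inj₂ lg)
      with ValidRoundProperties.logged-edge (proj₁ (closed r∈S)) lg
    ... | _ , ba , refl = exploredEdge-from (logged-explored r∈S lg) (lab-sym ba)

    exploredEdge⇒discovered : ∀ {a b} → ExploredEdge (a , b) → Discovered G δ S a b
    exploredEdge⇒discovered (ℓ , ab , explored , _) with explored-logs explored ab
    ... | r , r∈S , lg = r , r∈S , + ℓ , inj₁ lg

    δAdj-exploredEdge : ∀ {p q} → δAdj G δ p q → ExploredEdge p → ExploredEdge q
    δAdj-exploredEdge {a , b} {c , d} (ℓ , ℓ' , ab , cd , shared , close)
                      (_ , ab' , explored-a , explored-b) rewrite lab-functional ab' ab =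
      [ (λ explored-c → exploredEdge-sym (exploredEdge-from (spread explored-c cd) (lab-sym cd)))
      , (λ explored-d → exploredEdge-from (spread explored-d (lab-sym cd)) cd)
      ]′ (shared-explored shared)
      where
      spread : ∀ {u w} → Explored S u (+ ℓ) → lab G u w ≡ just ℓ' → Explored S w (+ ℓ')
      spread explored uw = explored-spreads-within-δ explored uw close

      shared-explored : ShareEndpoint G δ (a , b) (c , d) → Explored S c (+ ℓ) ⊎ Explored S d (+ ℓ)
      shared-explored (inj₁ refl) = inj₁ explored-a
      shared-explored (inj₂ (inj₁ refl)) = inj₂ explored-a
      shared-explored (inj₂ (inj₂ (inj₁ refl))) = inj₁ explored-b
      shared-explored (inj₂ (inj₂ (inj₂ refl))) = inj₂ explored-b

    sameComp-exploredEdge : ∀ {p q} → SameComp G δ p q → ExploredEdge p → ExploredEdge q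
    sameComp-exploredEdge =
      fold (λ p q → ExploredEdge p → ExploredEdge q) (λ adj next → next ∘ δAdj-exploredEdge adj) id

corollary2 : ∀ {n : ℕ} (G : TGraph n) (δ : ℕ) .{{_ : NonZero δ}} (S : State G δ) →
    FollowRun G δ S → ∀ (a b c d : Fin n) → Edge G δ a b →
    SameComp G δ (a , b) (c , d) → Discovered G δ S a b → Discovered G δ S c d
-- The hypothesis Edge G δ a b is implied by the discovery of ab.
corollary2 G δ S run a b c d _ sameComp discovered =
  exploredEdge⇒discovered (sameComp-exploredEdge sameComp (discovered⇒exploredEdge discovered))
  where
  open Exploration G δ
  open Closed S (follow-followedUp run)
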